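{- For all integers $m,n\ge 2$, the number of spotlight tilings of an $m\times n$ rectangle with its northeast corner square removed and the number of spotlight tilings of an $m\times n$ rectangle with its southwest corner square removed are both equal to $$T_{m,n}-1=\binom{m+n}{m}-\binom{m+n-2}{m-1}-1,$$ where $T_{m,n}$ is the number of spotlight tilings of the $m\times n$ rectangle.
   Context: A region is a finite set of unit squares of the square grid whose edge-adjacency graph is connected. A northwest corner of a region $R$ is a square of $R$ such that neither the square directly above it nor the square directly to its left belongs to $R$. A spotlight tiling of $R$ is produced recursively: choose a northwest corner $s$ of $R$ and place a spotlight with endpoint $s$, extending either east or south as far as possible, i.e. consisting of $s$ together with the maximal run of consecutive squares of $R$ in that direction. The uncovered squares form a disjoint union of regions (connected components), each of which is then given a spotlight tiling recursively; the empty region has exactly one (empty) tiling. The spotlight tiling is the final collection of spotlights; two spotlight tilings are the same if and only if they give the same collection of spotlights (order of placement is irrelevant, and a last-placed spotlight of length $1$ carries no direction). -}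

module Defs where

open import Data.Nat using (ℕ; zero; suc; _+_; _∸_; _≤_; _≤?_)
open import Data.Nat.Properties using (_≟_)
open import Data.Product using (Σ; _×_; _,_; proj₁; proj₂)
open import Data.Product.Properties using (≡-dec)
open import Data.List using (List; []; _∷_; filter; length; concatMap; upTo)
open import Data.List.Membership.Propositional using (_∈_; _∉_)
open import Data.List.Relation.Unary.All using (All)
open import Data.List.Relation.Unary.Any using (Any)
open import Data.List.Relation.Unary.AllPairs using (AllPairs)
open import Relation.Nullary using (¬_; ¬?; Dec)
open import Relation.Nullary.Decidable using (_×-dec_)
open import Relation.Binary.PropositionalEquality using (_≡_; _≢_)
open import Function.Bundles using (_⇔_)

-- A square of the grid: (row , column); rows increase going SOUTH (downwards),
-- columns increase going EAST (rightwards).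
Cell : Set
Cell = ℕ × ℕ

-- A region is a finite set of squares, represented by a list of cells
-- (set semantics: only membership _∈_ matters).
Region : Set
Region = List Cell

-- A spotlight is a horizontal or vertical segment of squares, recorded by its
-- two extreme squares (start , end) with start ≤ end coordinatewise.  A
-- spotlight of length 1 has start ≡ end and so carries no direction.
Spot : Set
Spot = Cell × Cell

_∈S_ : Cell → Spot → Set
(r , c) ∈S ((r₁ , c₁) , (r₂ , c₂)) = (r₁ ≤ r × r ≤ r₂) × (c₁ ≤ c × c ≤ c₂)

_∈S?_ : (x : Cell) → (s : Spot) → Dec (x ∈S s)
(r , c) ∈S? ((r₁ , c₁) , (r₂ , c₂)) =
  ((r₁ ≤? r) ×-dec (r ≤? r₂)) ×-dec ((c₁ ≤? c) ×-dec (c ≤? c₂))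

removeSpot : Region → Spot → Region
removeSpot R s = filter (λ x → ¬? (x ∈S? s)) R

NWCorner : Region → Cell → Set
NWCorner R (r , c) =
  ((r , c) ∈ R) ×
  ((∀ r' → suc r' ≡ r → (r' , c) ∉ R) ×
   (∀ c' → suc c' ≡ c → (r , c') ∉ R))

-- A spotlight is placed at a northwest corner
-- (r , c), extending east (or south) over the maximal run of k+1 consecutive
-- squares of R; the rest is tiled recursively.
data Tiling : Region → List Spot → Set where
  empty : Tiling [] []
  east  : ∀ {R T} r c k →
          NWCorner R (r , c) →
          (∀ j → j ≤ k → (r , c + j) ∈ R) →
          (r , c + suc k) ∉ R →
          Tiling (removeSpot R ((r , c) , (r , c + k))) T →
          Tiling R (((r , c) , (r , c + k)) ∷ T)
  south : ∀ {R T} r c k →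
          NWCorner R (r , c) →
          (∀ j → j ≤ k → (r + j , c) ∈ R) →
          (r + suc k , c) ∉ R →
          Tiling (removeSpot R ((r , c) , (r + k , c))) T →
          Tiling R (((r , c) , (r + k , c)) ∷ T)

SameCollection : List Spot → List Spot → Set
SameCollection T T' = ∀ s → (s ∈ T) ⇔ (s ∈ T')

NumTilings : Region → ℕ → Set
NumTilings R N =
  Σ (List (List Spot)) λ Ts →
    (length Ts ≡ N) ×
    (All (Tiling R) Ts) ×
    (AllPairs (λ T T' → ¬ SameCollection T T') Ts) ×
    (∀ T → Tiling R T → Any (SameCollection T) Ts)

rect : ℕ → ℕ → Region
rect m n = concatMap (λ r → Data.List.map (λ c → (r , c)) (upTo n)) (upTo m)
  where import Data.List

cellEq? : (x y : Cell) → Dec (x ≡ y)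
cellEq? = Data.Product.Properties.≡-dec _≟_ _≟_

removeCell : Region → Cell → Region
removeCell R x = filter (λ y → ¬? (cellEq? y x)) R

rectNE : ℕ → ℕ → Region
rectNE m n = removeCell (rect m n) (0 , n ∸ 1)

rectSW : ℕ → ℕ → Region
rectSW m n = removeCell (rect m n) (m ∸ 1 , 0)

module Submission where

-- All three shapes have a single northwest corner (a , b), so every spotlight
-- tiling opens with the maximal east or the maximal south spotlight at (a , b),
-- and the rest is a tiling of what that spotlight leaves uncovered.  When the
-- two spotlights differ, the count of the shape is therefore the sum of the
-- counts of the two residual shapes (the corner-split lemma below).
--
-- Iterating
-- the split gives the recurrence T(m+1,n+1) = T(m,n+1) + T(m+1,n) for boxes;
-- removing the northeast (southwest) corner gives a shape whose count telescopes
-- to T - 1, because its spotlight-splitting peels off full boxes down to a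
-- single column (row) which has one tiling fewer than the full box.  Finally
-- Pascal's rule identifies T(m,n) with C(m+n,m) - C(m+n-2,m-1).

open import Defs
open import Data.Nat using (ℕ; zero; suc; _+_; _∸_; _≤_; _<_; z≤n; s≤s; z<s; _<?_; _≤?_)
open import Data.Nat.Properties
open import Data.Nat.Combinatorics using (_C_; nCk≡nC[n∸k]; nCn≡1; nC1≡n; nCk+nC[k+1]≡[n+1]C[k+1])
open import Data.Product using (Σ; _×_; _,_; proj₁; proj₂)
open import Data.Sum using (_⊎_; inj₁; inj₂)
open import Data.List using (List; []; _∷_; _++_; map; length; upTo)
open import Data.List.Properties using (length-++; length-map)
open import Data.List.Membership.Propositional using (_∈_; _∉_; find; lose)
open import Data.List.Membership.Propositional.Properties
  using (∈-filter⁺; ∈-filter⁻; ∈-concatMap⁺; ∈-concatMap⁻; ∈-map⁺; ∈-map⁻; ∈-upTo⁺; ∈-upTo⁻)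
open import Data.List.Relation.Unary.All as All using (All; []; _∷_)
import Data.List.Relation.Unary.All.Properties as AllProps
open import Data.List.Relation.Unary.Any as Any using (Any; here; there)
import Data.List.Relation.Unary.Any.Properties as AnyProps
open import Data.List.Relation.Unary.AllPairs using (AllPairs; []; _∷_)
import Data.List.Relation.Unary.AllPairs.Properties as AllPairsProps
open import Data.Empty using (⊥-elim)
open import Relation.Nullary using (¬_; ¬?; yes; no)
open import Relation.Unary using (_≐_)
open import Relation.Unary.Properties using (≐-trans)
open import Relation.Binary.PropositionalEquality
open import Relation.Binary.Definitions using (tri<; tri≈; tri>)
open import Function.Bundles using (mk⇔; Equivalence)
open import Algebra.Properties.CommutativeSemigroup +-commutativeSemigroup using (interchange; xy∙z≈xz∙y)

Within : ℕ → ℕ → ℕ → Set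
Within a m r = a ≤ r × r < a + m

InBox : ℕ → ℕ → ℕ → ℕ → Cell → Set
InBox a b m n x = Within a m (proj₁ x) × Within b n (proj₂ x)

<-+suc : ∀ {r} a m → r < a + suc m → r ≤ a + m
<-+suc a m r< = ≤-pred (≤-trans r< (≤-reflexive (+-suc a m)))

within-first : ∀ {a m} → Within a (suc m) a
within-first {a} = ≤-refl , m<m+n a z<s

within-run : ∀ {b n j} → j ≤ n → Within b (suc n) (b + j)
within-run {b} {n} {j} j≤n = m≤m+n b j , +-monoʳ-< b (s≤s j≤n)

past-end : ∀ {b n} → ¬ Within b n (b + n)
past-end {b} {n} (_ , lt) = n≮n (b + n) lt

empty-interval : ∀ {a r} → ¬ Within a 0 r
empty-interval {a} (a≤r , r<a+0) =
  n≮n a (≤-<-trans a≤r (≤-trans r<a+0 (≤-reflexive (+-identityʳ a))))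

within-one : ∀ {a r} → Within a 1 r → r ≡ a
within-one {a} (a≤r , r<) = ≤-antisym (≤-trans (<-+suc a 0 r<) (≤-reflexive (+-identityʳ a))) a≤r

within-pred : ∀ {a m r} → a ≤ r → Within a m (suc r) → Within a m r
within-pred a≤r (_ , lt) = a≤r , <-trans (n<1+n _) lt

within-tail : ∀ {a m r} → a < r → Within a (suc m) r → Within (suc a) m r
within-tail {a} {m} a<r (_ , lt) = a<r , ≤-trans lt (≤-reflexive (+-suc a m))

within-untail : ∀ {a m r} → Within (suc a) m r → a < r × Within a (suc m) r
within-untail {a} {m} (a<r , lt) = a<r , (<⇒≤ a<r , ≤-trans lt (≤-reflexive (sym (+-suc a m))))

last-element : ∀ {b k c} → b + k < c → c < b + suc (suc k) → c ≡ b + suc k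
last-element {b} {k} past c< = ≤-antisym (<-+suc b (suc k) c<) (≤-trans (≤-reflexive (+-suc b k)) past)

no-extent : ∀ b {k} → b + k ≡ b → k ≡ 0
no-extent b {k} e = +-cancelˡ-≡ b k 0 (trans e (sym (+-identityʳ b)))

step-back : ∀ {a r} → a ≤ r → r ≢ a → Σ ℕ λ r' → suc r' ≡ r × a ≤ r'
step-back {r = zero}   z≤n    r≢a = ⊥-elim (r≢a refl)
step-back {r = suc r'} a≤1+r' r≢a = r' , refl , ≤-pred (≤∧≢⇒< a≤1+r' (λ e → r≢a (sym e)))

rows-differ : ∀ {r c r' c' : ℕ} → r ≢ r' → (r , c) ≢ (r' , c')
rows-differ r≢r' e = r≢r' (cong proj₁ e)

columns-differ : ∀ {r c r' c' : ℕ} → c ≢ c' → (r , c) ≢ (r' , c')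
columns-differ c≢c' e = c≢c' (cong proj₂ e)

-- Regions described by predicates

-- The list R describes the set of squares satisfying P.  Tilings only inspect
-- membership in R, so each shape is handled through such a description.
Describes : Region → (Cell → Set) → Set
Describes R P = (λ x → x ∈ R) ≐ P

rect-describes : ∀ m n → Describes (rect m n) (InBox 0 0 m n)
rect-describes m n = to , from
  where
  row : ℕ → List Cell
  row r = map (λ c → (r , c)) (upTo n)
  to : ∀ {x} → x ∈ rect m n → InBox 0 0 m n x
  to x∈ with find (∈-concatMap⁻ row {xs = upTo m} x∈)
  ... | r , r∈ , x∈row with ∈-map⁻ (λ c → (r , c)) x∈row
  ...   | c , c∈ , refl = (z≤n , ∈-upTo⁻ r∈) , (z≤n , ∈-upTo⁻ c∈)
  from : ∀ {x} → InBox 0 0 m n x → x ∈ rect m n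
  from {r , c} ((_ , r<m) , (_ , c<n)) =
    ∈-concatMap⁺ row {xs = upTo m} (lose (∈-upTo⁺ r<m) (∈-map⁺ (λ c → (r , c)) (∈-upTo⁺ c<n)))

removeCell-describes : ∀ {R P y} → Describes R P → Describes (removeCell R y) (λ x → P x × x ≢ y)
removeCell-describes {R} {y = y} (to , from) =
  (λ x∈ → let (x∈R , x≢y) = ∈-filter⁻ kept? {xs = R} x∈ in to x∈R , x≢y) ,
  (λ { (p , x≢y) → ∈-filter⁺ kept? (from p) x≢y })
  where kept? = λ z → ¬? (cellEq? z y)

removeSpot-describes : ∀ {R P} s → Describes R P →
                       Describes (removeSpot R s) (λ x → P x × ¬ x ∈S s)
removeSpot-describes {R} s (to , from) =
  (λ x∈ → let (x∈R , x∉s) = ∈-filter⁻ kept? {xs = R} x∈ in to x∈R , x∉s) ,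
  (λ { (p , x∉s) → ∈-filter⁺ kept? (from p) x∉s })
  where kept? = λ x → ¬? (x ∈S? s)

eastSpot southSpot : ℕ → ℕ → ℕ → Spot
eastSpot a b k = (a , b) , (a , b + k)
southSpot a b k = (a , b) , (a + k , b)

endpoint-∈-east : ∀ {a b k} → (a , b) ∈S eastSpot a b k
endpoint-∈-east {a} {b} {k} = (≤-refl , ≤-refl) , (≤-refl , m≤m+n b k)

endpoint-∈-south : ∀ {a b k} → (a , b) ∈S southSpot a b k
endpoint-∈-south {a} {b} {k} = (≤-refl , m≤m+n a k) , (≤-refl , ≤-refl)

outside-east : ∀ {a b k r c} → ¬ (r , c) ∈S eastSpot a b k → a ≤ r → b ≤ c →
               a < r ⊎ (r ≡ a × b + k < c)
outside-east {a} {b} {k} {r} {c} x∉ a≤r b≤c with a <? r | c ≤? b + k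
... | yes a<r | _       = inj₁ a<r
... | no  a≮r | yes c≤  = ⊥-elim (x∉ ((a≤r , ≮⇒≥ a≮r) , (b≤c , c≤)))
... | no  a≮r | no  c≰  = inj₂ (≤-antisym (≮⇒≥ a≮r) a≤r , ≰⇒> c≰)

outside-south : ∀ {a b k r c} → ¬ (r , c) ∈S southSpot a b k → a ≤ r → b ≤ c →
                b < c ⊎ (c ≡ b × a + k < r)
outside-south {a} {b} {k} {r} {c} x∉ a≤r b≤c with b <? c | r ≤? a + k
... | yes b<c | _       = inj₁ b<c
... | no  b≮c | yes r≤  = ⊥-elim (x∉ ((a≤r , r≤) , (b≤c , ≮⇒≥ b≮c)))
... | no  b≮c | no  r≰  = inj₂ (≤-antisym (≮⇒≥ b≮c) b≤c , ≰⇒> r≰)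

below-east : ∀ {a b k r c} → a < r → ¬ (r , c) ∈S eastSpot a b k
below-east a<r ((_ , r≤a) , _) = <⇒≱ a<r r≤a

right-of-south : ∀ {a b k r c} → b < c → ¬ (r , c) ∈S southSpot a b k
right-of-south b<c (_ , (_ , c≤b)) = <⇒≱ b<c c≤b

endpoint-∈ : ∀ {R T s} → Tiling R T → s ∈ T → proj₁ s ∈ R
endpoint-∈ (east _ _ _ (x∈ , _) _ _ _) (here refl) = x∈
endpoint-∈ {R} (east _ _ _ _ _ _ t) (there s∈) = proj₁ (∈-filter⁻ _ {xs = R} (endpoint-∈ t s∈))
endpoint-∈ (south _ _ _ (x∈ , _) _ _ _) (here refl) = x∈
endpoint-∈ {R} (south _ _ _ _ _ _ t) (there s∈) = proj₁ (∈-filter⁻ _ {xs = R} (endpoint-∈ t s∈))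

later-spots-avoid : ∀ {R T s s'} → Tiling (removeSpot R s') T → proj₁ s ∈S s' → s ∉ T
later-spots-avoid {R} {s' = s'} t start∈s' s∈ =
  proj₂ (∈-filter⁻ (λ x → ¬? (x ∈S? s')) {xs = R} (endpoint-∈ t s∈)) start∈s'

no-squares-tiling : ∀ {R T} → (∀ x → x ∉ R) → Tiling R T → T ≡ []
no-squares-tiling none empty = refl
no-squares-tiling none (east _ _ _ (x∈ , _) _ _ _) = ⊥-elim (none _ x∈)
no-squares-tiling none (south _ _ _ (x∈ , _) _ _ _) = ⊥-elim (none _ x∈)

no-squares⇒[] : ∀ {R : Region} → (∀ x → x ∉ R) → R ≡ []
no-squares⇒[] {[]} none = refl
no-squares⇒[] {x ∷ R} none = ⊥-elim (none x (here refl))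

same-refl : ∀ T → SameCollection T T
same-refl T s = mk⇔ (λ s∈ → s∈) (λ s∈ → s∈)

no-squares-count : ∀ {R} → (∀ x → x ∉ R) → NumTilings R 1
no-squares-count none =
  ([] ∷ []) , refl , (subst (λ R' → Tiling R' []) (sym (no-squares⇒[] none)) empty ∷ []) ,
  ([] ∷ []) , λ T t → here (subst (SameCollection T) (no-squares-tiling none t) (same-refl T))

MaxRun : (Cell → Set) → (ℕ → Cell) → ℕ → Set
MaxRun P f k = (∀ j → j ≤ k → P (f j)) × ¬ P (f (suc k))

maxRun-unique : ∀ {P f k k'} → MaxRun P f k → MaxRun P f k' → k ≡ k'
maxRun-unique {k = k} {k'} (run , end) (run' , end') with <-cmp k k'
... | tri< k<k' _ _ = ⊥-elim (end (run' (suc k) k<k'))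
... | tri≈ _ k≡k' _ = k≡k'
... | tri> _ _ k'<k = ⊥-elim (end' (run (suc k') k'<k))

maxRun-describes : ∀ {R P f k} → Describes R P → MaxRun P f k → MaxRun (λ x → x ∈ R) f k
maxRun-describes (to , from) (run , end) = (λ j j≤k → from (run j j≤k)) , (λ x∈ → end (to x∈))

same-cons : ∀ {s T T'} → SameCollection T T' → SameCollection (s ∷ T) (s ∷ T')
same-cons same x = mk⇔ (step (Equivalence.to (same x))) (step (Equivalence.from (same x)))
  where
  step : ∀ {U U'} → (x ∈ U → x ∈ U') → x ∈ _ ∷ U → x ∈ _ ∷ U'
  step f (here e) = here e
  step f (there x∈) = there (f x∈)

same-uncons : ∀ {s T T'} → s ∉ T → s ∉ T' →
              SameCollection (s ∷ T) (s ∷ T') → SameCollection T T'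
same-uncons s∉T s∉T' same x =
  mk⇔ (step s∉T (Equivalence.to (same x))) (step s∉T' (Equivalence.from (same x)))
  where
  step : ∀ {s U U'} → s ∉ U → (x ∈ s ∷ U → x ∈ s ∷ U') → x ∈ U → x ∈ U'
  step s∉U f x∈ with f (there x∈)
  ... | here refl = ⊥-elim (s∉U x∈)
  ... | there x∈' = x∈'

different-heads : ∀ {s s' T T'} → s ≢ s' → s ∉ T' → ¬ SameCollection (s ∷ T) (s' ∷ T')
different-heads s≢s' s∉T' same with Equivalence.to (same _) (here refl)
... | here s≡s' = s≢s' s≡s'
... | there s∈T' = s∉T' s∈T'

Distinct : List (List Spot) → Set
Distinct = AllPairs (λ T T' → ¬ SameCollection T T')

prefix-distinct : ∀ s {Ts} → All (s ∉_) Ts → Distinct Ts → Distinct (map (s ∷_) Ts)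
prefix-distinct s [] [] = []
prefix-distinct s {T ∷ Ts} (s∉T ∷ s∉Ts) (T≉Ts ∷ distinct) =
  AllProps.map⁺ (All.zipWith uncons (s∉Ts , T≉Ts)) ∷ prefix-distinct s s∉Ts distinct
  where
  uncons : ∀ {T'} → s ∉ T' × ¬ SameCollection T T' → ¬ SameCollection (s ∷ T) (s ∷ T')
  uncons (s∉T' , T≉T') same = T≉T' (same-uncons s∉T s∉T' same)

-- Shapes with a unique northwest corner

HasUpperOrLeft : (Cell → Set) → ℕ → ℕ → Set
HasUpperOrLeft P r c = (Σ ℕ λ r' → suc r' ≡ r × P (r' , c)) ⊎ (Σ ℕ λ c' → suc c' ≡ c × P (r , c'))

record RootedAt (P : Cell → Set) (a b : ℕ) : Set where
  field
    root      : P (a , b)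
    southeast : ∀ {r c} → P (r , c) → a ≤ r × b ≤ c
    linked    : ∀ {r c} → P (r , c) → (r , c) ≢ (a , b) → HasUpperOrLeft P r c

rooted-corner : ∀ {R P a b} → Describes R P → RootedAt P a b → NWCorner R (a , b)
rooted-corner (to , from) ρ =
  from root ,
  (λ r' e p → nothing-before (proj₁ (southeast (to p))) e) ,
  (λ c' e p → nothing-before (proj₂ (southeast (to p))) e)
  where
  open RootedAt ρ
  nothing-before : ∀ {a r'} → a ≤ r' → suc r' ≢ a
  nothing-before {r' = r'} a≤r' e = n≮n r' (≤-trans (≤-reflexive e) a≤r')

rooted-unique-corner : ∀ {R P a b} → Describes R P → RootedAt P a b →
                       ∀ q → NWCorner R q → q ≡ (a , b)
rooted-unique-corner {a = a} {b} (to , from) ρ (r , c) (q∈ , no-up , no-left)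
  with cellEq? (r , c) (a , b)
... | yes q≡root = q≡root
... | no  q≢root with RootedAt.linked ρ (to q∈) q≢root
...   | inj₁ (r' , e , p) = ⊥-elim (no-up r' e (from p))
...   | inj₂ (c' , e , p) = ⊥-elim (no-left c' e (from p))

rooted-by-rows : ∀ {P a b} → P (a , b) → (∀ {r c} → P (r , c) → a ≤ r × b ≤ c) →
  (∀ {r c} → a ≤ r → P (suc r , c) → P (r , c)) →
  (∀ {c} → b ≤ c → P (a , suc c) → P (a , c)) →
  RootedAt P a b
rooted-by-rows {P} {a} {b} root se up left = record { root = root ; southeast = se ; linked = linked }
  where
  linked : ∀ {r c} → P (r , c) → (r , c) ≢ (a , b) → HasUpperOrLeft P r c
  linked {r} {c} p x≢root with r ≟ a
  ... | no r≢a with step-back (proj₁ (se p)) r≢a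
  ...   | r' , refl , a≤r' = inj₁ (r' , refl , up a≤r' p)
  linked {r} {c} p x≢root | yes refl with step-back (proj₂ (se p)) (λ c≡b → x≢root (cong₂ _,_ refl c≡b))
  ...   | c' , refl , b≤c' = inj₂ (c' , refl , left b≤c' p)

rooted-by-columns : ∀ {P a b} → P (a , b) → (∀ {r c} → P (r , c) → a ≤ r × b ≤ c) →
  (∀ {r c} → b ≤ c → P (r , suc c) → P (r , c)) →
  (∀ {r} → a ≤ r → P (suc r , b) → P (r , b)) →
  RootedAt P a b
rooted-by-columns {P} {a} {b} root se left up = record { root = root ; southeast = se ; linked = linked }
  where
  linked : ∀ {r c} → P (r , c) → (r , c) ≢ (a , b) → HasUpperOrLeft P r c
  linked {r} {c} p x≢root with c ≟ b
  ... | no c≢b with step-back (proj₂ (se p)) c≢b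
  ...   | c' , refl , b≤c' = inj₂ (c' , refl , left b≤c' p)
  linked {r} {c} p x≢root | yes refl with step-back (proj₁ (se p)) (λ r≡a → x≢root (cong₂ _,_ r≡a refl))
  ...   | r' , refl , a≤r' = inj₁ (r' , refl , up a≤r' p)

module CornerSplit {R : Region} {P : Cell → Set} {a b k₁ k₂ : ℕ}
  (rep : Describes R P) (rooted : RootedAt P a b)
  (eastRun : MaxRun P (λ j → (a , b + j)) k₁) (southRun : MaxRun P (λ j → (a + j , b)) k₂) where

  sE sS : Spot
  sE = eastSpot a b k₁
  sS = southSpot a b k₂

  root∈sE : (a , b) ∈S sE
  root∈sE = endpoint-∈-east
  root∈sS : (a , b) ∈S sS
  root∈sS = endpoint-∈-south

  corner : NWCorner R (a , b)
  corner = rooted-corner rep rooted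

  eastRun∈ : MaxRun (λ x → x ∈ R) (λ j → (a , b + j)) k₁
  eastRun∈ = maxRun-describes rep eastRun

  southRun∈ : MaxRun (λ x → x ∈ R) (λ j → (a + j , b)) k₂
  southRun∈ = maxRun-describes rep southRun

  east-tiling : ∀ {T} → Tiling (removeSpot R sE) T → Tiling R (sE ∷ T)
  east-tiling = east a b k₁ corner (proj₁ eastRun∈) (proj₂ eastRun∈)

  south-tiling : ∀ {T} → Tiling (removeSpot R sS) T → Tiling R (sS ∷ T)
  south-tiling = south a b k₂ corner (proj₁ southRun∈) (proj₂ southRun∈)

  Opens : Spot → List Spot → Set
  Opens s T = Σ (List Spot) λ T' → T ≡ s ∷ T' × Tiling (removeSpot R s) T'

  -- the first spotlight sits at the unique corner and is maximal, so it is sE or sS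
  opening : ∀ {T} → Tiling R T → Opens sE T ⊎ Opens sS T
  opening empty with proj₁ corner   -- the empty region has no corner
  ... | ()
  opening (east _ _ _ nw run end t) with rooted-unique-corner rep rooted _ nw
  ... | refl with maxRun-unique {P = λ x → x ∈ R} {f = λ j → (a , b + j)} eastRun∈ (run , end)
  ...   | refl = inj₁ (_ , refl , t)
  opening (south _ _ _ nw run end t) with rooted-unique-corner rep rooted _ nw
  ... | refl with maxRun-unique {P = λ x → x ∈ R} {f = λ j → (a + j , b)} southRun∈ (run , end)
  ...   | refl = inj₂ (_ , refl , t)

  spots-differ : k₁ ≢ 0 ⊎ k₂ ≢ 0 → sE ≢ sS
  spots-differ (inj₁ k₁≢0) e = k₁≢0 (no-extent b (cong (λ s → proj₂ (proj₂ s)) e))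
  spots-differ (inj₂ k₂≢0) e = k₂≢0 (no-extent a (sym (cong (λ s → proj₁ (proj₂ s)) e)))

  split-count : ∀ {N₁ N₂} → k₁ ≢ 0 ⊎ k₂ ≢ 0 →
    NumTilings (removeSpot R sE) N₁ → NumTilings (removeSpot R sS) N₂ → NumTilings R (N₁ + N₂)
  split-count {N₁} {N₂} long (Ts₁ , len₁ , tiles₁ , distinct₁ , complete₁)
                             (Ts₂ , len₂ , tiles₂ , distinct₂ , complete₂) =
    Ts , length-Ts , tiles , distinct , complete
    where
    Ts = map (sE ∷_) Ts₁ ++ map (sS ∷_) Ts₂

    length-Ts : length Ts ≡ N₁ + N₂
    length-Ts = begin
      length Ts
        ≡⟨ length-++ (map (sE ∷_) Ts₁) ⟩
      length (map (sE ∷_) Ts₁) + length (map (sS ∷_) Ts₂)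
        ≡⟨ cong₂ _+_ (length-map _ Ts₁) (length-map _ Ts₂) ⟩
      length Ts₁ + length Ts₂
        ≡⟨ cong₂ _+_ len₁ len₂ ⟩
      N₁ + N₂
        ∎
      where open ≡-Reasoning

    tiles : All (Tiling R) Ts
    tiles = AllProps.++⁺ (AllProps.map⁺ (All.map east-tiling tiles₁))
                         (AllProps.map⁺ (All.map south-tiling tiles₂))

    sE∉Ts₁ : All (sE ∉_) Ts₁
    sE∉Ts₁ = All.map (λ t → later-spots-avoid {R} t root∈sE) tiles₁
    sS∉Ts₂ : All (sS ∉_) Ts₂
    sS∉Ts₂ = All.map (λ t → later-spots-avoid {R} t root∈sS) tiles₂
    sE∉Ts₂ : All (sE ∉_) Ts₂
    sE∉Ts₂ = All.map (λ t → later-spots-avoid {R} {s = sE} t root∈sS) tiles₂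

    east≉south : ∀ T → All (λ U → ¬ SameCollection (sE ∷ T) U) (map (sS ∷_) Ts₂)
    east≉south T = AllProps.map⁺ (All.map (different-heads (spots-differ long)) sE∉Ts₂)

    distinct : Distinct Ts
    distinct = AllPairsProps.++⁺ (prefix-distinct sE sE∉Ts₁ distinct₁)
                                 (prefix-distinct sS sS∉Ts₂ distinct₂)
                                 (AllProps.map⁺ (All.tabulate (λ {T} _ → east≉south T)))

    complete : ∀ T → Tiling R T → Any (SameCollection T) Ts
    complete T t with opening t
    ... | inj₁ (T' , refl , t') = AnyProps.++⁺ˡ (AnyProps.map⁺ (Any.map same-cons (complete₁ T' t')))
    ... | inj₂ (T' , refl , t') =
      AnyProps.++⁺ʳ (map (sE ∷_) Ts₁) (AnyProps.map⁺ (Any.map same-cons (complete₂ T' t')))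

-- a single square has exactly one tiling: both corner spotlights are that square
single-square : ∀ {R a b} → Describes R (_≡ (a , b)) → NumTilings R 1
single-square {R} {a} {b} rep =
  ((sE ∷ []) ∷ []) , refl , (east-tiling residual ∷ []) , ([] ∷ []) , complete
  where
  rooted : RootedAt (_≡ (a , b)) a b
  rooted = record
    { root      = refl
    ; southeast = λ { refl → ≤-refl , ≤-refl }
    ; linked    = λ { refl x≢root → ⊥-elim (x≢root refl) }
    }
  eastRun : MaxRun (_≡ (a , b)) (λ j → (a , b + j)) 0
  eastRun = (λ { zero z≤n → cong (a ,_) (+-identityʳ b) }) , (λ e → m+1+n≢m b (cong proj₂ e))
  southRun : MaxRun (_≡ (a , b)) (λ j → (a + j , b)) 0
  southRun = (λ { zero z≤n → cong (λ r → (r , b)) (+-identityʳ a) }) , (λ e → m+1+n≢m a (cong proj₁ e))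
  open CornerSplit rep rooted eastRun southRun
  nothing-left : ∀ {s} → (a , b) ∈S s → ∀ x → x ∉ removeSpot R s
  nothing-left {s} root∈s x x∈ with proj₁ (removeSpot-describes s rep) x∈
  ... | refl , x∉s = x∉s root∈s
  residual : Tiling (removeSpot R sE) []
  residual = subst (λ R' → Tiling R' []) (sym (no-squares⇒[] (nothing-left root∈sE))) empty
  sS≡sE : sS ≡ sE
  sS≡sE = cong ((a , b) ,_) (cong₂ _,_ (+-identityʳ a) (sym (+-identityʳ b)))
  complete : ∀ T → Tiling R T → Any (SameCollection T) ((sE ∷ []) ∷ [])
  complete T t with opening t
  ... | inj₁ (T' , refl , t')
    rewrite no-squares-tiling (nothing-left root∈sE) t' = here (same-refl _)
  ... | inj₂ (T' , refl , t')
    rewrite no-squares-tiling (nothing-left root∈sS) t' | sS≡sE = here (same-refl _)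

-- Boxes

boxCount : ℕ → ℕ → ℕ
boxCount zero          n             = 1
boxCount (suc m)       zero          = 1
boxCount (suc zero)    (suc zero)    = 1
boxCount (suc zero)    (suc (suc n)) = boxCount zero (suc (suc n)) + boxCount (suc zero) (suc n)
boxCount (suc (suc m)) (suc n)       = boxCount (suc m) (suc n) + boxCount (suc (suc m)) n

unit-box : ∀ a b → InBox a b 1 1 ≐ (_≡ (a , b))
unit-box a b = to , from
  where
  to : ∀ {x} → InBox a b 1 1 x → x ≡ (a , b)
  to {r , c} (rr , cc) = cong₂ _,_ (within-one rr) (within-one cc)
  from : ∀ {x} → x ≡ (a , b) → InBox a b 1 1 x
  from refl = within-first , within-first

module BoxFacts (a b m n : ℕ) where

  rooted : RootedAt (InBox a b (suc m) (suc n)) a b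
  rooted = rooted-by-rows (within-first , within-first) (λ p → proj₁ (proj₁ p) , proj₁ (proj₂ p))
    (λ a≤r p → within-pred a≤r (proj₁ p) , proj₂ p)
    (λ b≤c p → proj₁ p , within-pred b≤c (proj₂ p))

  eastRun : MaxRun (InBox a b (suc m) (suc n)) (λ j → (a , b + j)) n
  eastRun = (λ j j≤n → within-first , within-run j≤n) , (λ p → past-end (proj₂ p))

  southRun : MaxRun (InBox a b (suc m) (suc n)) (λ j → (a + j , b)) m
  southRun = (λ j j≤m → within-run j≤m , within-first) , (λ p → past-end (proj₁ p))

  eastResidual : (λ x → InBox a b (suc m) (suc n) x × ¬ x ∈S eastSpot a b n)
                 ≐ InBox (suc a) b m (suc n)
  eastResidual = to , from
    where
    to : ∀ {x} → InBox a b (suc m) (suc n) x × ¬ x ∈S eastSpot a b n → InBox (suc a) b m (suc n) x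
    to {r , c} ((rr , cc) , x∉) with outside-east x∉ (proj₁ rr) (proj₁ cc)
    ... | inj₁ a<r = within-tail a<r rr , cc
    ... | inj₂ (_ , past) = ⊥-elim (<⇒≱ past (<-+suc b n (proj₂ cc)))
    from : ∀ {x} → InBox (suc a) b m (suc n) x → InBox a b (suc m) (suc n) x × ¬ x ∈S eastSpot a b n
    from {r , c} (rr , cc) with within-untail rr
    ... | a<r , rr' = (rr' , cc) , below-east a<r

  southResidual : (λ x → InBox a b (suc m) (suc n) x × ¬ x ∈S southSpot a b m)
                  ≐ InBox a (suc b) (suc m) n
  southResidual = to , from
    where
    to : ∀ {x} → InBox a b (suc m) (suc n) x × ¬ x ∈S southSpot a b m → InBox a (suc b) (suc m) n x
    to {r , c} ((rr , cc) , x∉) with outside-south x∉ (proj₁ rr) (proj₁ cc)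
    ... | inj₁ b<c = rr , within-tail b<c cc
    ... | inj₂ (_ , past) = ⊥-elim (<⇒≱ past (<-+suc a m (proj₂ rr)))
    from : ∀ {x} → InBox a (suc b) (suc m) n x → InBox a b (suc m) (suc n) x × ¬ x ∈S southSpot a b m
    from {r , c} (rr , cc) with within-untail cc
    ... | b<c , cc' = (rr , cc') , right-of-south b<c

box-split : ∀ m n a b {R N₁ N₂} → Describes R (InBox a b (suc m) (suc n)) → n ≢ 0 ⊎ m ≢ 0 →
  (∀ {R'} → Describes R' (InBox (suc a) b m (suc n)) → NumTilings R' N₁) →
  (∀ {R'} → Describes R' (InBox a (suc b) (suc m) n) → NumTilings R' N₂) →
  NumTilings R (N₁ + N₂)
box-split m n a b rep long count₁ count₂ =
  split-count long (count₁ (≐-trans (removeSpot-describes _ rep) eastResidual))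
                   (count₂ (≐-trans (removeSpot-describes _ rep) southResidual))
  where
  open BoxFacts a b m n
  open CornerSplit rep rooted eastRun southRun

box-count : ∀ m n a b {R} → Describes R (InBox a b m n) → NumTilings R (boxCount m n)
box-count zero n a b rep = no-squares-count (λ _ x∈ → empty-interval (proj₁ (proj₁ rep x∈)))
box-count (suc m) zero a b rep = no-squares-count (λ _ x∈ → empty-interval (proj₂ (proj₁ rep x∈)))
box-count (suc zero) (suc zero) a b rep = single-square (≐-trans rep (unit-box a b))
box-count (suc zero) (suc (suc n)) a b rep =
  box-split 0 (suc n) a b rep (inj₁ (λ ()))
    (box-count 0 (suc (suc n)) (suc a) b) (box-count 1 (suc n) a (suc b))
box-count (suc (suc m)) (suc n) a b rep =
  box-split (suc m) n a b rep (inj₂ (λ ()))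
    (box-count (suc m) (suc n) (suc a) b) (box-count (suc (suc m)) n a (suc b))

-- The box with its northeast square removed

NEBox : ℕ → ℕ → ℕ → ℕ → Cell → Set
NEBox a b m n x = InBox a b (suc (suc m)) (suc n) x × x ≢ (a , b + n)

-- tilings opening eastwards tile the box below the top row, the others the
-- notched box one column narrower; the last one is a single column
neCount : ℕ → ℕ → ℕ
neCount m zero    = boxCount (suc m) 1
neCount m (suc n) = boxCount (suc m) (suc (suc n)) + neCount m n

ne-column : ∀ a b m → NEBox a b m 0 ≐ InBox (suc a) b (suc m) 1
ne-column a b m = to , from
  where
  to : ∀ {x} → NEBox a b m 0 x → InBox (suc a) b (suc m) 1 x
  to {r , c} ((rr , cc) , x≢notch) = within-tail a<r rr , cc
    where
    a<r : a < r
    a<r = ≤∧≢⇒< (proj₁ rr) λ a≡r →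
      x≢notch (cong₂ _,_ (sym a≡r) (trans (within-one cc) (sym (+-identityʳ b))))
  from : ∀ {x} → InBox (suc a) b (suc m) 1 x → NEBox a b m 0 x
  from {r , c} (rr , cc) with within-untail rr
  ... | a<r , rr' = (rr' , cc) , rows-differ (>⇒≢ a<r)

module NEFacts (a b m n : ℕ) where

  off-notch : ∀ {r c : ℕ} → c < b + suc n → (r , c) ≢ (a , b + suc n)
  off-notch c< = columns-differ (<⇒≢ c<)

  rooted : RootedAt (NEBox a b m (suc n)) a b
  rooted = rooted-by-columns ((within-first , within-first) , off-notch (m<m+n b z<s))
    (λ p → proj₁ (proj₁ (proj₁ p)) , proj₁ (proj₂ (proj₁ p)))
    (λ { b≤c ((rr , cc) , _) → (rr , within-pred b≤c cc) , off-notch (<-+suc b (suc n) (proj₂ cc)) })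
    (λ { a≤r ((rr , cc) , _) → (within-pred a≤r rr , cc) , off-notch (m<m+n b z<s) })

  eastRun : MaxRun (NEBox a b m (suc n)) (λ j → (a , b + j)) n
  eastRun =
    (λ j j≤n → (within-first , within-run (m≤n⇒m≤1+n j≤n)) , off-notch (+-monoʳ-< b (s≤s j≤n))) ,
    (λ p → proj₂ p refl)

  southRun : MaxRun (NEBox a b m (suc n)) (λ j → (a + j , b)) (suc m)
  southRun =
    (λ j j≤ → (within-run j≤ , within-first) , off-notch (m<m+n b z<s)) ,
    (λ p → past-end (proj₁ (proj₁ p)))

  eastResidual : (λ x → NEBox a b m (suc n) x × ¬ x ∈S eastSpot a b n)
                 ≐ InBox (suc a) b (suc m) (suc (suc n))
  eastResidual = to , from
    where
    to : ∀ {x} → NEBox a b m (suc n) x × ¬ x ∈S eastSpot a b n → InBox (suc a) b (suc m) (suc (suc n)) x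
    to {r , c} (((rr , cc) , x≢notch) , x∉) with outside-east x∉ (proj₁ rr) (proj₁ cc)
    ... | inj₁ a<r = within-tail a<r rr , cc
    ... | inj₂ (r≡a , past) = ⊥-elim (x≢notch (cong₂ _,_ r≡a (last-element past (proj₂ cc))))
    from : ∀ {x} → InBox (suc a) b (suc m) (suc (suc n)) x → NEBox a b m (suc n) x × ¬ x ∈S eastSpot a b n
    from {r , c} (rr , cc) with within-untail rr
    ... | a<r , rr' = ((rr' , cc) , rows-differ (>⇒≢ a<r)) , below-east a<r

  southResidual : (λ x → NEBox a b m (suc n) x × ¬ x ∈S southSpot a b (suc m))
                  ≐ NEBox a (suc b) m n
  southResidual = to , from
    where
    notch-moves : (a , b + suc n) ≡ (a , suc b + n)
    notch-moves = cong (a ,_) (+-suc b n)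
    to : ∀ {x} → NEBox a b m (suc n) x × ¬ x ∈S southSpot a b (suc m) → NEBox a (suc b) m n x
    to {r , c} (((rr , cc) , x≢notch) , x∉) with outside-south x∉ (proj₁ rr) (proj₁ cc)
    ... | inj₁ b<c = (rr , within-tail b<c cc) , (λ e → x≢notch (trans e (sym notch-moves)))
    ... | inj₂ (_ , past) = ⊥-elim (<⇒≱ past (<-+suc a (suc m) (proj₂ rr)))
    from : ∀ {x} → NEBox a (suc b) m n x → NEBox a b m (suc n) x × ¬ x ∈S southSpot a b (suc m)
    from {r , c} ((rr , cc) , x≢notch) with within-untail cc
    ... | b<c , cc' = ((rr , cc') , (λ e → x≢notch (trans e notch-moves))) , right-of-south b<c

ne-count : ∀ m n a b {R} → Describes R (NEBox a b m n) → NumTilings R (neCount m n)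
ne-count m zero a b rep = box-count (suc m) 1 (suc a) b (≐-trans rep (ne-column a b m))
ne-count m (suc n) a b rep =
  split-count (inj₂ (λ ()))
    (box-count (suc m) (suc (suc n)) (suc a) b (≐-trans (removeSpot-describes _ rep) eastResidual))
    (ne-count m n a (suc b) (≐-trans (removeSpot-describes _ rep) southResidual))
  where
  open NEFacts a b m n
  open CornerSplit rep rooted eastRun southRun

-- The box with its southwest square removed

SWBox : ℕ → ℕ → ℕ → ℕ → Cell → Set
SWBox a b m n x = InBox a b (suc m) (suc (suc n)) x × x ≢ (a + m , b)

-- tilings opening southwards tile the box right of the first column, the
-- others the notched box one row shorter; the last one is a single row
swCount : ℕ → ℕ → ℕ
swCount zero    n = boxCount 1 (suc n)
swCount (suc m) n = swCount m n + boxCount (suc (suc m)) (suc n)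

sw-row : ∀ a b n → SWBox a b 0 n ≐ InBox a (suc b) 1 (suc n)
sw-row a b n = to , from
  where
  to : ∀ {x} → SWBox a b 0 n x → InBox a (suc b) 1 (suc n) x
  to {r , c} ((rr , cc) , x≢notch) = rr , within-tail b<c cc
    where
    b<c : b < c
    b<c = ≤∧≢⇒< (proj₁ cc) λ b≡c →
      x≢notch (cong₂ _,_ (trans (within-one rr) (sym (+-identityʳ a))) (sym b≡c))
  from : ∀ {x} → InBox a (suc b) 1 (suc n) x → SWBox a b 0 n x
  from {r , c} (rr , cc) with within-untail cc
  ... | b<c , cc' = (rr , cc') , columns-differ (>⇒≢ b<c)

module SWFacts (a b m n : ℕ) where

  off-notch : ∀ {r c : ℕ} → r < a + suc m → (r , c) ≢ (a + suc m , b)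
  off-notch r< = rows-differ (<⇒≢ r<)

  rooted : RootedAt (SWBox a b (suc m) n) a b
  rooted = rooted-by-rows ((within-first , within-first) , off-notch (m<m+n a z<s))
    (λ p → proj₁ (proj₁ (proj₁ p)) , proj₁ (proj₂ (proj₁ p)))
    (λ { a≤r ((rr , cc) , _) → (within-pred a≤r rr , cc) , off-notch (<-+suc a (suc m) (proj₂ rr)) })
    (λ { b≤c ((rr , cc) , _) → (rr , within-pred b≤c cc) , off-notch (m<m+n a z<s) })

  eastRun : MaxRun (SWBox a b (suc m) n) (λ j → (a , b + j)) (suc n)
  eastRun =
    (λ j j≤ → (within-first , within-run j≤) , off-notch (m<m+n a z<s)) ,
    (λ p → past-end (proj₂ (proj₁ p)))

  southRun : MaxRun (SWBox a b (suc m) n) (λ j → (a + j , b)) m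
  southRun =
    (λ j j≤m → (within-run (m≤n⇒m≤1+n j≤m) , within-first) , off-notch (+-monoʳ-< a (s≤s j≤m))) ,
    (λ p → proj₂ p refl)

  eastResidual : (λ x → SWBox a b (suc m) n x × ¬ x ∈S eastSpot a b (suc n))
                 ≐ SWBox (suc a) b m n
  eastResidual = to , from
    where
    notch-moves : (a + suc m , b) ≡ (suc a + m , b)
    notch-moves = cong (λ r → (r , b)) (+-suc a m)
    to : ∀ {x} → SWBox a b (suc m) n x × ¬ x ∈S eastSpot a b (suc n) → SWBox (suc a) b m n x
    to {r , c} (((rr , cc) , x≢notch) , x∉) with outside-east x∉ (proj₁ rr) (proj₁ cc)
    ... | inj₁ a<r = (within-tail a<r rr , cc) , (λ e → x≢notch (trans e (sym notch-moves)))
    ... | inj₂ (_ , past) = ⊥-elim (<⇒≱ past (<-+suc b (suc n) (proj₂ cc)))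
    from : ∀ {x} → SWBox (suc a) b m n x → SWBox a b (suc m) n x × ¬ x ∈S eastSpot a b (suc n)
    from {r , c} ((rr , cc) , x≢notch) with within-untail rr
    ... | a<r , rr' = ((rr' , cc) , (λ e → x≢notch (trans e notch-moves))) , below-east a<r

  southResidual : (λ x → SWBox a b (suc m) n x × ¬ x ∈S southSpot a b m)
                  ≐ InBox a (suc b) (suc (suc m)) (suc n)
  southResidual = to , from
    where
    to : ∀ {x} → SWBox a b (suc m) n x × ¬ x ∈S southSpot a b m → InBox a (suc b) (suc (suc m)) (suc n) x
    to {r , c} (((rr , cc) , x≢notch) , x∉) with outside-south x∉ (proj₁ rr) (proj₁ cc)
    ... | inj₁ b<c = rr , within-tail b<c cc
    ... | inj₂ (c≡b , past) = ⊥-elim (x≢notch (cong₂ _,_ (last-element past (proj₂ rr)) c≡b))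
    from : ∀ {x} → InBox a (suc b) (suc (suc m)) (suc n) x → SWBox a b (suc m) n x × ¬ x ∈S southSpot a b m
    from {r , c} (rr , cc) with within-untail cc
    ... | b<c , cc' = ((rr , cc') , columns-differ (>⇒≢ b<c)) , right-of-south b<c

sw-count : ∀ m n a b {R} → Describes R (SWBox a b m n) → NumTilings R (swCount m n)
sw-count zero n a b rep = box-count 1 (suc n) a (suc b) (≐-trans rep (sw-row a b n))
sw-count (suc m) n a b rep =
  split-count (inj₁ (λ ()))
    (sw-count m n (suc a) b (≐-trans (removeSpot-describes _ rep) eastResidual))
    (box-count (suc (suc m)) (suc n) a (suc b) (≐-trans (removeSpot-describes _ rep) southResidual))
  where
  open SWFacts a b m n
  open CornerSplit rep rooted eastRun southRun

-- The counts in closed form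

boxCount-row : ∀ n → boxCount 1 (suc n) ≡ suc n
boxCount-row zero    = refl
boxCount-row (suc n) = cong suc (boxCount-row n)

boxCount-column : ∀ m → boxCount (suc m) 1 ≡ suc m
boxCount-column zero    = refl
boxCount-column (suc m) = trans (cong (_+ 1) (boxCount-column m)) (+-comm (suc m) 1)

[1+n]Cn≡1+n : ∀ n → suc n C n ≡ suc n
[1+n]Cn≡1+n n = begin
  suc n C n              ≡⟨ nCk≡nC[n∸k] (n≤1+n n) ⟩
  suc n C (suc n ∸ n)    ≡⟨ cong (suc n C_) (m+n∸n≡m 1 n) ⟩
  suc n C 1              ≡⟨ nC1≡n (suc n) ⟩
  suc n                  ∎
  where open ≡-Reasoning

boxCount-binomial : ∀ m n → boxCount (suc m) (suc n) + (m + n) C m ≡ (suc m + suc n) C suc m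
boxCount-binomial zero n = begin
  boxCount 1 (suc n) + 1    ≡⟨ cong (_+ 1) (boxCount-row n) ⟩
  suc n + 1                 ≡⟨ +-comm (suc n) 1 ⟩
  suc (suc n)               ≡⟨ sym (nC1≡n (suc (suc n))) ⟩
  suc (suc n) C 1           ∎
  where open ≡-Reasoning
boxCount-binomial (suc m) zero = begin
  boxCount (suc (suc m)) 1 + (suc m + 0) C suc m
    ≡⟨ cong₂ _+_ (boxCount-column (suc m)) (trans (cong (_C suc m) (+-identityʳ (suc m))) (nCn≡1 (suc m))) ⟩
  suc (suc m) + 1
    ≡⟨ +-comm (suc (suc m)) 1 ⟩
  suc (suc (suc m))
    ≡⟨ sym ([1+n]Cn≡1+n (suc (suc m))) ⟩
  suc (suc (suc m)) C suc (suc m)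
    ≡⟨ cong (_C suc (suc m)) (sym (+-comm (suc (suc m)) 1)) ⟩
  (suc (suc m) + 1) C suc (suc m)
    ∎
  where open ≡-Reasoning
boxCount-binomial (suc m) (suc n) = begin
  (A + B) + suc N C suc m                ≡⟨ cong ((A + B) +_) (sym (nCk+nC[k+1]≡[n+1]C[k+1] N m)) ⟩
  (A + B) + (N C m + N C suc m)          ≡⟨ interchange A B (N C m) (N C suc m) ⟩
  (A + N C m) + (B + N C suc m)          ≡⟨ cong₂ _+_ (boxCount-binomial m (suc n)) south-part ⟩
  N' C suc m + suc (suc N) C suc (suc m) ≡⟨ cong (λ k → N' C suc m + k C suc (suc m)) (sym N'≡2+N) ⟩
  N' C suc m + N' C suc (suc m)          ≡⟨ nCk+nC[k+1]≡[n+1]C[k+1] N' (suc m) ⟩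
  suc N' C suc (suc m)                   ∎
  where
  open ≡-Reasoning
  A = boxCount (suc m) (suc (suc n))
  B = boxCount (suc (suc m)) (suc n)
  N = m + suc n
  N' = suc m + suc (suc n)
  N'≡2+N : N' ≡ suc (suc N)
  N'≡2+N = cong suc (+-suc m (suc n))
  south-part : B + N C suc m ≡ suc (suc N) C suc (suc m)
  south-part = trans (cong (λ k → B + k C suc m) (+-suc m n)) (boxCount-binomial (suc m) n)

neCount-boxCount : ∀ m n → neCount m n + 1 ≡ boxCount (suc (suc m)) (suc n)
neCount-boxCount m zero    = refl
neCount-boxCount m (suc n) =
  trans (+-assoc (boxCount (suc m) (suc (suc n))) (neCount m n) 1)
        (cong (boxCount (suc m) (suc (suc n)) +_) (neCount-boxCount m n))

swCount-boxCount : ∀ m n → swCount m n + 1 ≡ boxCount (suc m) (suc (suc n))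
swCount-boxCount zero    n = +-comm (boxCount 1 (suc n)) 1
swCount-boxCount (suc m) n =
  trans (xy∙z≈xz∙y (swCount m n) (boxCount (suc (suc m)) (suc n)) 1)
        (cong (_+ boxCount (suc (suc m)) (suc n)) (swCount-boxCount m n))

cancel-+ : ∀ {x y z} → x + y ≡ z → x ≡ z ∸ y
cancel-+ {x} {y} e = trans (sym (m+n∸n≡m x y)) (cong (_∸ y) e)

proposition4p3 : ∀ (m n : ℕ) → 2 ≤ m → 2 ≤ n →
    NumTilings (rect m n) ((m + n) C m ∸ (m + n ∸ 2) C (m ∸ 1)) ×
    (NumTilings (rectNE m n) ((m + n) C m ∸ (m + n ∸ 2) C (m ∸ 1) ∸ 1) ×
     NumTilings (rectSW m n) ((m + n) C m ∸ (m + n ∸ 2) C (m ∸ 1) ∸ 1))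
proposition4p3 (suc (suc m)) (suc (suc n)) (s≤s (s≤s _)) (s≤s (s≤s _)) =
  subst (NumTilings (rect M N)) T≡formula (box-count M N 0 0 rect-M×N) ,
  (subst (NumTilings (rectNE M N)) (one-less (neCount-boxCount m (suc n)))
     (ne-count m (suc n) 0 0 (removeCell-describes rect-M×N)) ,
   subst (NumTilings (rectSW M N)) (one-less (swCount-boxCount (suc m) n))
     (sw-count (suc m) n 0 0 (removeCell-describes rect-M×N)))
  where
  M N : ℕ
  M = suc (suc m)
  N = suc (suc n)
  rect-M×N : Describes (rect M N) (InBox 0 0 M N)
  rect-M×N = rect-describes M N
  T≡formula : boxCount M N ≡ (M + N) C M ∸ (M + N ∸ 2) C (M ∸ 1)
  T≡formula = cancel-+ (begin
    boxCount M N + (m + N) C suc m         ≡⟨ cong (λ k → boxCount M N + k C suc m) (+-suc m (suc n)) ⟩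
    boxCount M N + (suc m + suc n) C suc m ≡⟨ boxCount-binomial (suc m) (suc n) ⟩
    (M + N) C M                            ∎)
    where open ≡-Reasoning
  one-less : ∀ {k} → k + 1 ≡ boxCount M N → k ≡ (M + N) C M ∸ (M + N ∸ 2) C (M ∸ 1) ∸ 1
  one-less e = trans (cancel-+ e) (cong (_∸ 1) T≡formula)
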